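{- The system $(\mathbf{ECN})^\Delta$ (axiomatized by TAUT, $\Delta$Equ, $\Delta$C, $\Delta$N and the rules modus ponens and RE$\Delta$) is sound and strongly complete with respect to the class of all neighborhood frames satisfying $(i)$, $(c)$ and $(n)$.
   Context: The language $\mathcal{L}(\Delta)$ is given by $\phi::=p\mid\neg\phi\mid\phi\land\phi\mid\Delta\phi$ with $p$ ranging over a fixed countably infinite set $\mathbf{P}$ of propositional variables; $\top$ is a fixed tautology. A neighborhood model is $\mathcal{M}=\langle S,N,V\rangle$ with $S\neq\emptyset$, $N:S\to\mathcal{P}(\mathcal{P}(S))$, $V:\mathbf{P}\to\mathcal{P}(S)$. Truth: $\mathcal{M},s\vDash p$ iff $s\in V(p)$; Boolean clauses as usual; $\mathcal{M},s\vDash\Delta\phi$ iff $\phi^{\mathcal{M}}\in N(s)$ or $S\setminus\phi^{\mathcal{M}}\in N(s)$, with $\phi^{\mathcal{M}}$ the truth set of $\phi$. Frame properties, required for every $s\in S$: $(n)$ $S\in N(s)$; $(i)$ $X,Y\in N(s)$ implies $X\cap Y\in N(s)$; $(c)$ $X\in N(s)$ implies $S\setminus X\in N(s)$. Axioms/rules: TAUT, $\Delta$Equ: $\Delta\phi\leftrightarrow\Delta\neg\phi$; $\Delta$C: $\Delta\phi\land\Delta\psi\to\Delta(\phi\land\psi)$; $\Delta$N: $\Delta\top$; RE$\Delta$: from $\phi\leftrightarrow\psi$ infer $\Delta\phi\leftrightarrow\Delta\psi$; plus modus ponens. Soundness: every theorem is valid on every frame of the class. Strong completeness: for every set $\Gamma$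 and formula $\phi$, if $\phi$ holds at every state of every model on a frame in the class where all of $\Gamma$ holds, then $\phi$ is derivable from $\Gamma$. -}

module Defs where

open import Data.Nat using (ℕ)
open import Data.Bool using (Bool; true; false; not; _∧_; _∨_)
open import Data.List using (List; []; _∷_)
open import Data.List.Relation.Unary.All using (All)
open import Data.Product using (Σ; _×_; _,_)
open import Relation.Binary.PropositionalEquality using (_≡_)

infixr 6 _∧̇_
data Form : Set where
  var : ℕ → Form
  ¬̇_  : Form → Form
  _∧̇_ : Form → Form → Form
  Δ   : Form → Form

_⇒_ : Form → Form → Form
φ ⇒ ψ = ¬̇ (φ ∧̇ ¬̇ ψ)

_⇔_ : Form → Form → Form
φ ⇔ ψ = (φ ⇒ ψ) ∧̇ (ψ ⇒ φ)

⊤̇ : Form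
⊤̇ = ¬̇ (var 0 ∧̇ ¬̇ var 0)

-- TAUT: φ is (a substitution instance of) a propositional tautology,
-- i.e. true under every Boolean valuation of all formulas that commutes
-- with ¬ and ∧ (Δ-formulas and variables are treated as atoms).

IsBoolVal : (Form → Bool) → Set
IsBoolVal v = (∀ φ → v (¬̇ φ) ≡ not (v φ)) × (∀ φ ψ → v (φ ∧̇ ψ) ≡ (v φ ∧ v ψ))

Taut : Form → Set
Taut φ = ∀ (v : Form → Bool) → IsBoolVal v → v φ ≡ true

data ⊢_ : Form → Set where
  taut : ∀ {φ} → Taut φ → ⊢ φ
  ΔEqu : ∀ {φ} → ⊢ (Δ φ ⇔ Δ (¬̇ φ))
  ΔC   : ∀ {φ ψ} → ⊢ ((Δ φ ∧̇ Δ ψ) ⇒ Δ (φ ∧̇ ψ))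
  ΔN   : ⊢ Δ ⊤̇
  mp   : ∀ {φ ψ} → ⊢ (φ ⇒ ψ) → ⊢ φ → ⊢ ψ
  REΔ  : ∀ {φ ψ} → ⊢ (φ ⇔ ψ) → ⊢ (Δ φ ⇔ Δ ψ)

⋀ : List Form → Form
⋀ []       = ⊤̇
⋀ (φ ∷ φs) = φ ∧̇ ⋀ φs

_⊢ᴳ_ : (Form → Set) → Form → Set
Γ ⊢ᴳ φ = Σ (List Form) λ ψs → All Γ ψs × (⊢ (⋀ ψs ⇒ φ))

-- A subset of S is represented by its characteristic function S → Bool;
-- subsets are identified up to pointwise equality, so a neighborhood
-- function must respect that identification (field `ext`).

record Frame : Set₁ where
  field
    S   : Set
    inh : S
    N   : S → (S → Bool) → Bool   -- N s X ≡ true  means  X ∈ N(s)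
    ext : ∀ s (X Y : S → Bool) → (∀ x → X x ≡ Y x) → N s X ≡ N s Y

open Frame public

HasN : Frame → Set
HasN F = ∀ s → N F s (λ _ → true) ≡ true

HasI : Frame → Set
HasI F = ∀ s (X Y : S F → Bool) → N F s X ≡ true → N F s Y ≡ true →
         N F s (λ x → X x ∧ Y x) ≡ true

HasC : Frame → Set
HasC F = ∀ s (X : S F → Bool) → N F s X ≡ true → N F s (λ x → not (X x)) ≡ true

InClass : Frame → Set
InClass F = HasN F × HasI F × HasC F

⟦_⟧ : Form → (F : Frame) → (ℕ → S F → Bool) → S F → Bool
⟦ var p ⟧   F V s = V p s
⟦ ¬̇ φ ⟧     F V s = not (⟦ φ ⟧ F V s)
⟦ φ ∧̇ ψ ⟧   F V s = ⟦ φ ⟧ F V s ∧ ⟦ ψ ⟧ F V s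
⟦ Δ φ ⟧     F V s = N F s (⟦ φ ⟧ F V) ∨ N F s (λ x → not (⟦ φ ⟧ F V x))

ValidInClass : Form → Set₁
ValidInClass φ = ∀ (F : Frame) → InClass F → ∀ (V : ℕ → S F → Bool) (s : S F) →
                 ⟦ φ ⟧ F V s ≡ true

_⊨_ : (Form → Set) → Form → Set₁
Γ ⊨ φ = ∀ (F : Frame) → InClass F → ∀ (V : ℕ → S F → Bool) (s : S F) →
        (∀ ψ → Γ ψ → ⟦ ψ ⟧ F V s ≡ true) → ⟦ φ ⟧ F V s ≡ true

-- Soundness: ΔEqu and REΔ hold on every frame, ΔN needs (n), and ΔC needs (i) together
-- with (c), which lets either disjunct of Δφ be read as "the truth set of φ is a
-- neighbourhood".  Completeness: a state is a Boolean valuation of formulas making every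
-- theorem true, and Lindenbaum's lemma separates Γ from any φ with Γ ⊬ φ by a state.  In
-- the canonical frame N(w) consists of the truth sets |ψ| with Δψ true at w.  This
-- respects truth sets, because |ψ| = |χ| forces ⊢ ψ ⇔ χ and hence ⊢ Δψ ⇔ Δχ by REΔ; its
-- closure under (n), (i), (c) is ΔN, ΔC, ΔEqu; and the truth lemma turns the separating
-- state into a countermodel.
module Submission where

open import Defs
open import Data.Product using (_×_)
open import Level using (0ℓ)
open import Axiom.ExcludedMiddle using (ExcludedMiddle)

open import Data.Bool using (Bool; true; false; not; _∧_; _∨_)
open import Data.Bool.Properties using (∧-conicalˡ; ∧-conicalʳ; ∨-comm; ∨-idem; not-involutive; not-¬)
open import Data.Empty using (⊥; ⊥-elim)
open import Data.List using (List; []; _∷_; _++_; foldr; map; cartesianProductWith)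
open import Data.List.Membership.Propositional using (_∈_)
open import Data.List.Membership.Propositional.Properties
  using (∈-++⁺ˡ; ∈-++⁺ʳ; ∈-map⁺; ∈-cartesianProductWith⁺)
open import Data.List.Relation.Unary.All using (All; []; _∷_)
import Data.List.Relation.Unary.All as All
open import Data.List.Relation.Unary.All.Properties using (++⁺; ++⁻)
open import Data.List.Relation.Unary.Any using (here; there)
open import Data.Nat using (ℕ; zero; suc; _⊔_; _≤′_; ≤′-refl; ≤′-step)
open import Data.Nat.Properties using (m≤m⊔n; m≤n⊔m; ≤⇒≤′)
open import Data.Product using (Σ; ∃; _,_; proj₁; proj₂)
open import Data.Sum using (_⊎_; inj₁; inj₂; [_,_]′)
open import Function using (_∘_; id; mk⇔)
import Function
open import Relation.Nullary using (¬_; yes; no; does; ¬?; _×-dec_)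
open import Relation.Nullary.Decidable using (dec-true; dec-false; does-⇔)
open import Relation.Binary.PropositionalEquality using (_≡_; refl; sym; trans; cong; cong₂)
open import Relation.Binary.PropositionalEquality.Properties using (module ≡-Reasoning)

private
  variable
    a b χ θ : Form
    ψs : List Form
    Γ : Form → Set

Holds : (Form → Bool) → Form → Set
Holds v ψ = v ψ ≡ true

infixr 5 _⇛_
infix 4 _⊨ᵇ_

_⇛_ : List Form → Form → Form
ψs ⇛ χ = foldr _⇒_ χ ψs

_⊨ᵇ_ : List Form → Form → Set
ψs ⊨ᵇ χ = ∀ v → IsBoolVal v → All (Holds v) ψs → Holds v χ

module BoolVal {v : Form → Bool} (bv : IsBoolVal v) where

  ¬-intro : v a ≡ false → Holds v (¬̇ a)
  ¬-intro {a} e = trans (proj₁ bv a) (cong not e)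

  ¬-elim : Holds v (¬̇ a) → v a ≡ false
  ¬-elim {a} e = trans (sym (not-involutive (v a))) (cong not (trans (sym (proj₁ bv a)) e))

  ∧-intro : Holds v a → Holds v b → Holds v (a ∧̇ b)
  ∧-intro {a} {b} ea eb = trans (proj₂ bv a b) (cong₂ _∧_ ea eb)

  ∧-elim : Holds v (a ∧̇ b) → Holds v a × Holds v b
  ∧-elim {a} {b} e = ∧-conicalˡ _ _ e′ , ∧-conicalʳ _ _ e′
    where e′ = trans (sym (proj₂ bv a b)) e

  ⇒-intro : (Holds v a → Holds v b) → Holds v (a ⇒ b)
  ⇒-intro {a} {b} h with v (a ∧̇ ¬̇ b) in e
  ... | false = ¬-intro e
  ... | true  = ⊥-elim (not-¬ (h (proj₁ (∧-elim e))) (¬-elim (proj₂ (∧-elim e))))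

  ⇒-elim : Holds v (a ⇒ b) → Holds v a → Holds v b
  ⇒-elim {a} {b} h ea with v b in e
  ... | true  = refl
  ... | false = ⊥-elim (not-¬ (∧-intro ea (¬-intro e)) (¬-elim h))

  ⊤-holds : Holds v ⊤̇
  ⊤-holds = ⇒-intro id

  ⇔-intro : v a ≡ v b → Holds v (a ⇔ b)
  ⇔-intro e = ∧-intro (⇒-intro (trans (sym e))) (⇒-intro (trans e))

  ⇔-elim : Holds v (a ⇔ b) → v a ≡ v b
  ⇔-elim {a} {b} h with v a in ea | v b in eb
  ... | true  | true  = refl
  ... | false | false = refl
  ... | true  | false = ⊥-elim (not-¬ (⇒-elim (proj₁ (∧-elim h)) ea) eb)
  ... | false | true  = ⊥-elim (not-¬ (⇒-elim (proj₂ (∧-elim h)) eb) ea)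

  ⋀-intro : All (Holds v) ψs → Holds v (⋀ ψs)
  ⋀-intro []       = ⊤-holds
  ⋀-intro (e ∷ es) = ∧-intro e (⋀-intro es)

  ⋀-elim : ∀ ψs → Holds v (⋀ ψs) → All (Holds v) ψs
  ⋀-elim []       _ = []
  ⋀-elim (ψ ∷ ψs) e = proj₁ (∧-elim e) ∷ ⋀-elim ψs (proj₂ (∧-elim e))

  ⇛-intro : ∀ ψs → (All (Holds v) ψs → Holds v χ) → Holds v (ψs ⇛ χ)
  ⇛-intro []       h = h []
  ⇛-intro (ψ ∷ ψs) h = ⇒-intro λ e → ⇛-intro ψs (h ∘ (e ∷_))

open BoolVal

explosion : a ∷ ¬̇ a ∷ [] ⊨ᵇ χ
explosion v bv (ea ∷ ena ∷ []) = ⊥-elim (not-¬ ea (¬-elim bv ena))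

by-cases : (a ⇒ χ) ∷ ((¬̇ a) ⇒ χ) ∷ [] ⊨ᵇ χ
by-cases {a} v bv (h ∷ h′ ∷ []) with v a in ea
... | true  = ⇒-elim bv h ea
... | false = ⇒-elim bv h′ (¬-intro bv ea)

⇛-taut : ψs ⊨ᵇ χ → Taut (ψs ⇛ χ)
⇛-taut {ψs} h v bv = ⇛-intro bv ψs (h v bv)

mp* : {D : Form → Set} → (∀ {a b} → D (a ⇒ b) → D a → D b) →
      D (ψs ⇛ χ) → All D ψs → D χ
mp* mp′ d []       = d
mp* mp′ d (e ∷ es) = mp* mp′ (mp′ d e) es

⊢-tautological : ψs ⊨ᵇ χ → All ⊢_ ψs → ⊢ χ
⊢-tautological h = mp* mp (taut (⇛-taut h))

-- Derivability from premises

⊢ᴳ-theorem : ⊢ χ → Γ ⊢ᴳ χ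
⊢ᴳ-theorem d = [] , [] , ⊢-tautological (λ { v bv (e ∷ []) → ⇒-intro bv λ _ → e }) (d ∷ [])

⊢ᴳ-assumption : Γ χ → Γ ⊢ᴳ χ
⊢ᴳ-assumption γ = _ ∷ [] , γ ∷ [] , taut λ v bv → ⇒-intro bv (proj₁ ∘ ∧-elim bv)

⊢ᴳ-mp : Γ ⊢ᴳ (a ⇒ b) → Γ ⊢ᴳ a → Γ ⊢ᴳ b
⊢ᴳ-mp {a = a} {b} (ps , γps , d) (qs , γqs , e) =
  ps ++ qs , ++⁺ γps γqs , ⊢-tautological entails (d ∷ e ∷ [])
  where
  entails : (⋀ ps ⇒ (a ⇒ b)) ∷ (⋀ qs ⇒ a) ∷ [] ⊨ᵇ ⋀ (ps ++ qs) ⇒ b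
  entails v bv (d ∷ e ∷ []) = ⇒-intro bv λ h →
    let (hps , hqs) = ++⁻ ps (⋀-elim bv (ps ++ qs) h)
    in  ⇒-elim bv (⇒-elim bv d (⋀-intro bv hps)) (⇒-elim bv e (⋀-intro bv hqs))

⊢ᴳ-tautological : ψs ⊨ᵇ χ → All (Γ ⊢ᴳ_) ψs → Γ ⊢ᴳ χ
⊢ᴳ-tautological h = mp* ⊢ᴳ-mp (⊢ᴳ-theorem (taut (⇛-taut h)))

∅⊢ᴳ⇒⊢ : (λ _ → ⊥) ⊢ᴳ χ → ⊢ χ
∅⊢ᴳ⇒⊢ ([] , [] , d) = ⊢-tautological (λ { v bv (e ∷ []) → ⇒-elim bv e (⊤-holds bv) }) (d ∷ [])

_▸_ : (Form → Set) → Form → Form → Set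
(Γ ▸ a) ψ = Γ ψ ⊎ ψ ≡ a

deduction : (Γ ▸ a) ⊢ᴳ b → Γ ⊢ᴳ (a ⇒ b)
deduction {Γ} {a} (ψs , γs , d) = go ψs γs d
  where
  curry : ∀ {ψ ψs b} → ⊢ (⋀ (ψ ∷ ψs) ⇒ b) → ⊢ (⋀ ψs ⇒ (ψ ⇒ b))
  curry d = ⊢-tautological (λ { v bv (e ∷ []) → ⇒-intro bv λ hs → ⇒-intro bv λ h →
              ⇒-elim bv e (∧-intro bv h hs) }) (d ∷ [])

  go : ∀ ψs {b} → All (Γ ▸ a) ψs → ⊢ (⋀ ψs ⇒ b) → Γ ⊢ᴳ (a ⇒ b)
  go [] [] d = ⊢ᴳ-theorem (⊢-tautological
    (λ { v bv (e ∷ []) → ⇒-intro bv λ _ → ⇒-elim bv e (⊤-holds bv) }) (d ∷ []))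
  go (ψ ∷ ψs) (inj₁ γ ∷ γs) d = ⊢ᴳ-tautological
    (λ { v bv (e ∷ eψ ∷ []) → ⇒-intro bv λ ea → ⇒-elim bv (⇒-elim bv e ea) eψ })
    (go ψs γs (curry d) ∷ ⊢ᴳ-assumption γ ∷ [])
  go (ψ ∷ ψs) (inj₂ refl ∷ γs) d = ⊢ᴳ-tautological
    (λ { v bv (e ∷ []) → ⇒-intro bv λ ea → ⇒-elim bv (⇒-elim bv e ea) ea })
    (go ψs γs (curry d) ∷ [])

-- Soundness

⟦⟧-isBoolVal : (F : Frame) (V : ℕ → S F → Bool) (s : S F) → IsBoolVal (λ ψ → ⟦ ψ ⟧ F V s)
⟦⟧-isBoolVal F V s = (λ _ → refl) , (λ _ _ → refl)

N-complement : (F : Frame) → ∀ s (X : S F → Bool) →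
               N F s (λ x → not (not (X x))) ≡ N F s X
N-complement F s X = ext F s _ X (λ x → not-involutive (X x))

∈N-of-Δ : (F : Frame) → HasC F → ∀ s (X : S F → Bool) →
          N F s X ∨ N F s (λ x → not (X x)) ≡ true → N F s X ≡ true
∈N-of-Δ F hc s X e with N F s X in eX
... | true  = refl
... | false = ⊥-elim (not-¬ (trans (sym (N-complement F s X)) (hc s (λ x → not (X x)) e)) eX)

∨-trueˡ : ∀ {x y} → x ≡ true → x ∨ y ≡ true
∨-trueˡ refl = refl

sound : ⊢ θ → ValidInClass θ
sound (taut t) F _ V s = t _ (⟦⟧-isBoolVal F V s)
sound (mp {φ} {ψ} d e) F cl V s =
  ⇒-elim (⟦⟧-isBoolVal F V s) {φ} {ψ} (sound d F cl V s) (sound e F cl V s)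
sound ΔN F (hn , _ , _) V s =
  ∨-trueˡ (trans (ext F s _ _ (λ x → ⊤-holds (⟦⟧-isBoolVal F V x))) (hn s))
sound (ΔEqu {φ}) F _ V s = ⇔-intro (⟦⟧-isBoolVal F V s) {Δ φ} {Δ (¬̇ φ)}
  (trans (∨-comm (N F s X) _) (cong (N F s (λ x → not (X x)) ∨_) (sym (N-complement F s X))))
  where X = ⟦ φ ⟧ F V
sound (ΔC {φ} {ψ}) F (_ , hi , hc) V s = ⇒-intro bv {Δ φ ∧̇ Δ ψ} {Δ (φ ∧̇ ψ)} λ e →
  let (eφ , eψ) = ∧-elim bv {Δ φ} {Δ ψ} e
  in  ∨-trueˡ (hi s _ _ (∈N-of-Δ F hc s _ eφ) (∈N-of-Δ F hc s _ eψ))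
  where bv = ⟦⟧-isBoolVal F V s
sound (REΔ {φ} {ψ} d) F cl V s = ⇔-intro (⟦⟧-isBoolVal F V s) {Δ φ} {Δ ψ}
  (cong₂ _∨_ (ext F s _ _ φ≗ψ) (ext F s _ _ (cong not ∘ φ≗ψ)))
  where
  φ≗ψ : ∀ x → ⟦ φ ⟧ F V x ≡ ⟦ ψ ⟧ F V x
  φ≗ψ x = ⇔-elim (⟦⟧-isBoolVal F V x) {φ} {ψ} (sound d F cl V x)

-- An exhaustion of the language by finite levels

level : ℕ → List Form
level zero    = var zero ∷ []
level (suc k) = level k ++ var (suc k) ∷ map ¬̇_ (level k) ++ map Δ (level k)
                        ++ cartesianProductWith _∧̇_ (level k) (level k)

level-mono : ∀ {k j} → k ≤′ j → a ∈ level k → a ∈ level j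
level-mono ≤′-refl      a∈ = a∈
level-mono (≤′-step k≤j) a∈ = ∈-++⁺ˡ (level-mono k≤j a∈)

∈-level : ∀ a → ∃ λ k → a ∈ level k
∈-level (var zero)    = zero , here refl
∈-level (var (suc p)) = suc p , ∈-++⁺ʳ (level p) (here refl)
∈-level (¬̇ a) with ∈-level a
... | k , a∈ = suc k , ∈-++⁺ʳ (level k) (there (∈-++⁺ˡ (∈-map⁺ ¬̇_ a∈)))
∈-level (Δ a) with ∈-level a
... | k , a∈ = suc k ,
  ∈-++⁺ʳ (level k) (there (∈-++⁺ʳ (map ¬̇_ (level k)) (∈-++⁺ˡ (∈-map⁺ Δ a∈))))
∈-level (a ∧̇ b) with ∈-level a | ∈-level b
... | i , a∈ | j , b∈ = suc k ,
  ∈-++⁺ʳ (level k) (there (∈-++⁺ʳ (map ¬̇_ (level k)) (∈-++⁺ʳ (map Δ (level k))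
    (∈-cartesianProductWith⁺ _∧̇_ (level-mono (≤⇒≤′ (m≤m⊔n i j)) a∈)
                                  (level-mono (≤⇒≤′ (m≤n⊔m i j)) b∈)))))
  where k = i ⊔ j

-- States and Lindenbaum's lemma

record State : Set where
  field
    val       : Form → Bool
    isBoolVal : IsBoolVal val
    ⊢⇒holds   : ∀ {θ} → ⊢ θ → Holds val θ

open State

Separates : State → (Form → Set) → Form → Set
Separates u Γ φ = (∀ {ψ} → Γ ψ → Holds (val u) ψ) × val u φ ≡ false

maximal⇒state : ExcludedMiddle 0ℓ → {M : Form → Set} {φ : Form} →
                (∀ a → M a ⊎ M (¬̇ a)) → ¬ (M ⊢ᴳ φ) → Σ State λ u → Separates u M φ
maximal⇒state em {M} {φ} decides M⊬φ = state , dec-true em , dec-false em (M⊬φ ∘ ⊢ᴳ-assumption)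
  where
  closed : M ⊢ᴳ χ → M χ
  closed {χ} M⊢χ with decides χ
  ... | inj₁ m  = m
  ... | inj₂ m¬ = ⊥-elim (M⊬φ (⊢ᴳ-tautological explosion (M⊢χ ∷ ⊢ᴳ-assumption m¬ ∷ [])))

  ¬-iff : M (¬̇ a) Function.⇔ (¬ M a)
  ¬-iff {a} = mk⇔
    (λ m¬ m → M⊬φ (⊢ᴳ-tautological explosion (⊢ᴳ-assumption m ∷ ⊢ᴳ-assumption m¬ ∷ [])))
    (λ ¬m → [ ⊥-elim ∘ ¬m , id ]′ (decides a))

  ∧-iff : M (a ∧̇ b) Function.⇔ (M a × M b)
  ∧-iff {a} {b} = mk⇔
    (λ m → closed (⊢ᴳ-tautological (λ { v bv (e ∷ []) → proj₁ (∧-elim bv e) }) (⊢ᴳ-assumption m ∷ []))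
         , closed (⊢ᴳ-tautological (λ { v bv (e ∷ []) → proj₂ (∧-elim bv e) }) (⊢ᴳ-assumption m ∷ [])))
    (λ (ma , mb) → closed (⊢ᴳ-tautological (λ { v bv (ea ∷ eb ∷ []) → ∧-intro bv ea eb })
                                           (⊢ᴳ-assumption ma ∷ ⊢ᴳ-assumption mb ∷ [])))

  state : State
  state = record
    { val       = λ ψ → does (em {M ψ})
    ; isBoolVal = (λ a → does-⇔ ¬-iff em (¬? em)) , (λ a b → does-⇔ ∧-iff em (em ×-dec em))
    ; ⊢⇒holds   = dec-true em ∘ closed ∘ ⊢ᴳ-theorem
    }

module Lindenbaum (em : ExcludedMiddle 0ℓ) (φ : Form) where

  choice : (Form → Set) → Form → Form
  choice Θ a with em {(Θ ▸ a) ⊢ᴳ φ}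
  ... | yes _ = ¬̇ a
  ... | no  _ = a

  extend : (Form → Set) → Form → Form → Set
  extend Θ a = Θ ▸ choice Θ a

  extend-decides : ∀ Θ a → extend Θ a a ⊎ extend Θ a (¬̇ a)
  extend-decides Θ a with em {(Θ ▸ a) ⊢ᴳ φ}
  ... | yes _ = inj₂ (inj₂ refl)
  ... | no  _ = inj₁ (inj₂ refl)

  extend-⊬ : ∀ {Θ} a → ¬ (Θ ⊢ᴳ φ) → ¬ (extend Θ a ⊢ᴳ φ)
  extend-⊬ {Θ} a Θ⊬φ with em {(Θ ▸ a) ⊢ᴳ φ}
  ... | no  Θa⊬φ = Θa⊬φ
  ... | yes Θa⊢φ = λ Θ¬a⊢φ →
    Θ⊬φ (⊢ᴳ-tautological by-cases (deduction Θa⊢φ ∷ deduction Θ¬a⊢φ ∷ []))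

  run : (Form → Set) → List Form → Form → Set
  run Θ []       = Θ
  run Θ (a ∷ as) = run (extend Θ a) as

  run-⊇ : ∀ Θ as {ψ} → Θ ψ → run Θ as ψ
  run-⊇ Θ []       δ = δ
  run-⊇ Θ (a ∷ as) δ = run-⊇ (extend Θ a) as (inj₁ δ)

  run-⊬ : ∀ {Θ} as → ¬ (Θ ⊢ᴳ φ) → ¬ (run Θ as ⊢ᴳ φ)
  run-⊬ []       Θ⊬φ = Θ⊬φ
  run-⊬ (a ∷ as) Θ⊬φ = run-⊬ as (extend-⊬ a Θ⊬φ)

  run-decides : ∀ Θ {as a} → a ∈ as → run Θ as a ⊎ run Θ as (¬̇ a)
  run-decides Θ {a ∷ as} (here refl) with extend-decides Θ a
  ... | inj₁ δ = inj₁ (run-⊇ _ as δ)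
  ... | inj₂ δ = inj₂ (run-⊇ _ as δ)
  run-decides Θ {b ∷ as} (there a∈) = run-decides (extend Θ b) a∈

  module _ (Γ : Form → Set) where

    stage : ℕ → Form → Set
    stage zero    = Γ
    stage (suc k) = run (stage k) (level k)

    stage-mono : ∀ {k j ψ} → k ≤′ j → stage k ψ → stage j ψ
    stage-mono ≤′-refl                 σ = σ
    stage-mono (≤′-step {j} k≤j) σ = run-⊇ (stage j) (level j) (stage-mono k≤j σ)

    stage-⊬ : ∀ k → ¬ (Γ ⊢ᴳ φ) → ¬ (stage k ⊢ᴳ φ)
    stage-⊬ zero    Γ⊬φ = Γ⊬φ
    stage-⊬ (suc k) Γ⊬φ = run-⊬ (level k) (stage-⊬ k Γ⊬φ)

    limit : Form → Set
    limit ψ = ∃ λ k → stage k ψ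

    limit-decides : ∀ a → limit a ⊎ limit (¬̇ a)
    limit-decides a with ∈-level a
    ... | k , a∈ with run-decides (stage k) a∈
    ...   | inj₁ σ = inj₁ (suc k , σ)
    ...   | inj₂ σ = inj₂ (suc k , σ)

    limit-compact : All limit ψs → ∃ λ k → All (stage k) ψs
    limit-compact [] = zero , []
    limit-compact ((i , σ) ∷ σs) with limit-compact σs
    ... | j , τs = i ⊔ j , stage-mono (≤⇒≤′ (m≤m⊔n i j)) σ
                         ∷ All.map (stage-mono (≤⇒≤′ (m≤n⊔m i j))) τs

    limit-⊬ : ¬ (Γ ⊢ᴳ φ) → ¬ (limit ⊢ᴳ φ)
    limit-⊬ Γ⊬φ (ψs , σs , d) with limit-compact σs
    ... | k , τs = stage-⊬ k Γ⊬φ (ψs , τs , d)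

lindenbaum : ExcludedMiddle 0ℓ → {φ : Form} → ¬ (Γ ⊢ᴳ φ) → Σ State λ u → Separates u Γ φ
lindenbaum em {φ} Γ⊬φ with maximal⇒state em (limit-decides _) (limit-⊬ _ Γ⊬φ)
  where open Lindenbaum em φ
... | u , limit⊆u , φ-false = u , (λ γ → limit⊆u (zero , γ)) , φ-false

-- The canonical model

module Canonical (em : ExcludedMiddle 0ℓ) (w₀ : State) where
  open ≡-Reasoning

  ⊢-of-holds-everywhere : (∀ u → Holds (val u) θ) → ⊢ θ
  ⊢-of-holds-everywhere {θ} h with em {(λ _ → ⊥) ⊢ᴳ θ}
  ... | yes ∅⊢θ = ∅⊢ᴳ⇒⊢ ∅⊢θ
  ... | no  ∅⊬θ with lindenbaum em ∅⊬θ
  ...   | u , _ , θ-false = ⊥-elim (not-¬ (h u) θ-false)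

  ∣_∣ : Form → State → Bool
  ∣ ψ ∣ u = val u ψ

  Δ-extensional : ∀ w {χ ψ} → (∀ u → ∣ χ ∣ u ≡ ∣ ψ ∣ u) → val w (Δ χ) ≡ val w (Δ ψ)
  Δ-extensional w χ≗ψ = ⇔-elim (isBoolVal w)
    (⊢⇒holds w (REΔ (⊢-of-holds-everywhere λ u → ⇔-intro (isBoolVal u) (χ≗ψ u))))

  ΔTruthSet : State → (State → Bool) → Set
  ΔTruthSet w X = ∃ λ ψ → (∀ u → X u ≡ ∣ ψ ∣ u) × Holds (val w) (Δ ψ)

  Nᶜ : State → (State → Bool) → Bool
  Nᶜ w X = does (em {ΔTruthSet w X})

  Nᶜ-ext : ∀ w (X Y : State → Bool) → (∀ u → X u ≡ Y u) → Nᶜ w X ≡ Nᶜ w Y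
  Nᶜ-ext w X Y X≗Y = does-⇔
    (mk⇔ (λ (ψ , X≗ψ , Δψ) → ψ , (λ u → trans (sym (X≗Y u)) (X≗ψ u)) , Δψ)
         (λ (ψ , Y≗ψ , Δψ) → ψ , (λ u → trans (X≗Y u) (Y≗ψ u)) , Δψ))
    em em

  Nᶜ-witness : ∀ w X → Nᶜ w X ≡ true → ΔTruthSet w X
  Nᶜ-witness w X e with em {ΔTruthSet w X}
  ... | yes t = t

  Nᶜ-truthSet : ∀ w ψ → Nᶜ w ∣ ψ ∣ ≡ val w (Δ ψ)
  Nᶜ-truthSet w ψ with val w (Δ ψ) in e
  ... | true  = dec-true em (ψ , (λ _ → refl) , e)
  ... | false = dec-false em λ (χ , ψ≗χ , Δχ) →
    not-¬ (trans (Δ-extensional w ψ≗χ) Δχ) e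

  canonicalFrame : Frame
  canonicalFrame = record { S = State ; inh = w₀ ; N = Nᶜ ; ext = Nᶜ-ext }

  canonicalFrame-inClass : InClass canonicalFrame
  canonicalFrame-inClass = hasN , hasI , hasC
    where
    hasN : HasN canonicalFrame
    hasN w = dec-true em (⊤̇ , (λ u → sym (⊤-holds (isBoolVal u))) , ⊢⇒holds w ΔN)

    hasI : HasI canonicalFrame
    hasI w X Y eX eY with Nᶜ-witness w X eX | Nᶜ-witness w Y eY
    ... | ψ , X≗ψ , Δψ | χ , Y≗χ , Δχ = dec-true em
      ( ψ ∧̇ χ
      , (λ u → trans (cong₂ _∧_ (X≗ψ u) (Y≗χ u)) (sym (proj₂ (isBoolVal u) ψ χ)))
      , ⇒-elim (isBoolVal w) (⊢⇒holds w ΔC) (∧-intro (isBoolVal w) Δψ Δχ))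

    hasC : HasC canonicalFrame
    hasC w X eX with Nᶜ-witness w X eX
    ... | ψ , X≗ψ , Δψ = dec-true em
      ( ¬̇ ψ
      , (λ u → trans (cong not (X≗ψ u)) (sym (proj₁ (isBoolVal u) ψ)))
      , trans (sym (⇔-elim (isBoolVal w) (⊢⇒holds w ΔEqu))) Δψ)

  canonicalValuation : ℕ → State → Bool
  canonicalValuation p = ∣ var p ∣

  truth-¬ : ∀ a → (∀ u → ⟦ a ⟧ canonicalFrame canonicalValuation u ≡ val u a) →
            ∀ u → ⟦ ¬̇ a ⟧ canonicalFrame canonicalValuation u ≡ val u (¬̇ a)
  truth-¬ a h u = trans (cong not (h u)) (sym (proj₁ (isBoolVal u) a))

  truth : ∀ ψ u → ⟦ ψ ⟧ canonicalFrame canonicalValuation u ≡ val u ψ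
  truth (var p)   u = refl
  truth (¬̇ a)     u = truth-¬ a (truth a) u
  truth (a ∧̇ b)   u = trans (cong₂ _∧_ (truth a u) (truth b u)) (sym (proj₂ (isBoolVal u) a b))
  truth (Δ a)     u = begin
      Nᶜ u ⟦a⟧ ∨ Nᶜ u (not ∘ ⟦a⟧)
        ≡⟨ cong₂ _∨_ (Nᶜ-ext u _ _ (truth a)) (Nᶜ-ext u _ _ (truth-¬ a (truth a))) ⟩
      Nᶜ u ∣ a ∣ ∨ Nᶜ u ∣ ¬̇ a ∣
        ≡⟨ cong₂ _∨_ (Nᶜ-truthSet u a) (Nᶜ-truthSet u (¬̇ a)) ⟩
      val u (Δ a) ∨ val u (Δ (¬̇ a))
        ≡⟨ cong (val u (Δ a) ∨_) (sym (⇔-elim (isBoolVal u) (⊢⇒holds u ΔEqu))) ⟩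
      val u (Δ a) ∨ val u (Δ a)
        ≡⟨ ∨-idem _ ⟩
      val u (Δ a)
        ∎
    where
    ⟦a⟧ = ⟦ a ⟧ canonicalFrame canonicalValuation

complete : ExcludedMiddle 0ℓ → ∀ (Γ : Form → Set) (φ : Form) → Γ ⊨ φ → Γ ⊢ᴳ φ
complete em Γ φ Γ⊨φ with em {Γ ⊢ᴳ φ}
... | yes Γ⊢φ = Γ⊢φ
... | no  Γ⊬φ with lindenbaum em Γ⊬φ
...   | u , Γ⊆u , φ-false = ⊥-elim (not-¬ φ-holds φ-false)
  where
  open Canonical em u
  φ-holds : val u φ ≡ true
  φ-holds = trans (sym (truth φ u))
    (Γ⊨φ canonicalFrame canonicalFrame-inClass canonicalValuation u
      (λ ψ γ → trans (truth ψ u) (Γ⊆u γ)))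

mainTheorem5 : (∀ {φ} → ⊢ φ → ValidInClass φ)
               × (ExcludedMiddle 0ℓ → ∀ (Γ : Form → Set) (φ : Form) → Γ ⊨ φ → Γ ⊢ᴳ φ)
mainTheorem5 = sound , complete
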